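{- Let $0\le k\le k+p<n$, let $A=a_1\cdots a_n$ be a binary string with $k\le w(A)\le k+p+1$, let $A^\infty=a_1a_2\cdots$ be generated from $A$ by the symmetric shift register with parameters $k,p,n$, and let $w_i=a_{i+1}+\cdots+a_{i+n}-k$ for $i\ge0$. Let $x=\min\{w_i:0\le i\le 2n\}$, $y=\max\{w_i:0\le i\le 2n\}$, $k^*=k+x$ and $p^*=y-x-1$. Then for every $r\ge0$: $a_{r+n+1}=1-a_{r+1}$ if and only if $k^*\le a_{r+2}+\cdots+a_{r+n}\le k^*+p^*$.
   Context: $w(A)$ is the number of 1's in $A$. The symmetric shift register with parameters $k,p,n$ generates $A^\infty=a_1a_2\cdots$ from $A$ by: for $i\ge0$, $a_{n+i+1}=1-a_{i+1}$ if $k\le a_{i+2}+\cdots+a_{i+n}\le k+p$, and $a_{n+i+1}=a_{i+1}$ otherwise. -}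

module Defs where

open import Data.Bool using (Bool; true; false; not; if_then_else_; _∧_)
open import Data.Nat using (ℕ; zero; suc; _+_; _*_; _∸_; _≤ᵇ_)
open import Data.Vec using (Vec; []; _∷_; _∷ʳ_)
open import Data.List using (List; map; foldr; upTo)
open import Data.Integer using (ℤ; +_; _-_; _⊓_; _⊔_)

bit : Bool → ℕ
bit true  = 1
bit false = 0

weight : ∀ {n} → Vec Bool n → ℕ
weight []       = 0
weight (x ∷ xs) = bit x + weight xs

sumFrom : (ℕ → ℕ) → ℕ → ℕ → ℕ
sumFrom f a zero      = 0
sumFrom f a (suc len) = f a + sumFrom f (suc a) len

module _ (k p : ℕ) where

  step : ∀ {n} → Vec Bool n → Vec Bool n
  step []       = []
  step (x ∷ xs) =
    xs ∷ʳ (if (k ≤ᵇ weight xs) ∧ (weight xs ≤ᵇ k + p) then not x else x)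

  -- window i = a_{i+1} … a_{i+n}
  window : ∀ {n} → Vec Bool n → ℕ → Vec Bool n
  window A zero    = A
  window A (suc i) = step (window A i)

  firstBit : ∀ {n} → Vec Bool n → ℕ
  firstBit []      = 0
  firstBit (x ∷ _) = bit x

  -- seqA A j = a_j  (1-indexed; meaningful for j ≥ 1)
  seqA : ∀ {n} → Vec Bool n → ℕ → ℕ
  seqA A j = firstBit (window A (j ∸ 1))

  wI : ∀ {n} → Vec Bool n → ℕ → ℤ
  wI {n} A i = + sumFrom (seqA A) (suc i) n - + k

  minW : ∀ {n} → Vec Bool n → ℤ
  minW {n} A = foldr _⊓_ (wI A 0) (map (wI A) (upTo (suc (2 * n))))

  maxW : ∀ {n} → Vec Bool n → ℤ
  maxW {n} A = foldr _⊔_ (wI A 0) (map (wI A) (upTo (suc (2 * n))))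

  kStar : ∀ {n} → Vec Bool n → ℤ
  kStar A = + k Data.Integer.+ minW A

  pStar : ∀ {n} → Vec Bool n → ℤ
  pStar A = maxW A - minW A - + 1

{-# OPTIONS --safe #-}
-- Write V i = a_{i+1} + ⋯ + a_{i+n} for the weight of the i-th window (so w_i = V i - k) and
-- S i = V i - a_{i+1}. The register flips a_{i+1} exactly when k ≤ S i ≤ k + p, so V (i+1) = V i
-- unless it flips, and then {V i, V (i+1)} = {S i, S i + 1}; hence k ≤ V i ≤ k + p + 1 for all i,
-- and if X ≤ V ≤ Y everywhere with k ≤ X and Y ≤ k + p + 1, a flip at r happens iff X ≤ S r < Y.
-- It remains to see that the global minimum and maximum of V are attained among V 0, …, V (2n).
-- Since V (j+1) - V j = a_{j+n+1} - a_{j+1}, the pair sums V j + V (j+n) change by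
-- a_{j+2n+1} - a_{j+1}. If a_{j+1} = 0 and a_{j+2n+1} = 1, the register cannot flip both at j and
-- at j + n: without a flip at j, V j = k + p + 1 is maximal; without one at j + n, V (j+n+1) = k is
-- minimal. Walking the pairs down from (c+n, c+2n) to (c, c+n) thus bounds V (c+2n) by an earlier
-- window, and the minimum follows by the same argument applied to -V.

module Submission where

open import Defs
open import Algebra.Definitions using (Selective)
open import Data.Bool using (Bool; true; false; not; if_then_else_)
open import Data.Bool.Properties using (not-involutive)
open import Data.Integer
  using (ℤ; +_; -_; _-_; pred; 0ℤ; +≤+; +<+)
  renaming (_≤_ to _≤ℤ_; _+_ to _+ℤ_; _⊓_ to _⊓ℤ_; _⊔_ to _⊔ℤ_)
open import Data.Integer.Properties as ℤ
  using (neg-mono-≤; neg-cancel-≤; drop‿+≤+; drop‿+<+; i≤pred[j]⇒i<j; i<j⇒i≤pred[j]; ⊓-sel; ⊔-sel;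
         i≤j⇒i⊓k≤j; i≤j⇒k⊓i≤j; i≤j⇒i≤j⊔k; i≤j⇒i≤k⊔j; i≤j⇒i-j≤0)
open import Data.Integer.Tactic.RingSolver using (solve-∀)
open import Data.List using (List; foldr; map; upTo)
open import Data.List.Membership.Propositional using (_∈_; lose)
open import Data.List.Membership.Propositional.Properties using (foldr-selective; ∈-map⁺; ∈-map⁻; ∈-upTo⁺)
open import Data.List.Properties using (foldr-preservesᵒ)
open import Data.Nat using (ℕ; zero; suc; _+_; _*_; _∸_; _≤_; _<_; NonZero; >-nonZero⁻¹; s≤s; z≤n; s≤s⁻¹)
open import Data.Nat.Induction using (<-rec)
open import Data.Nat.Properties
  using (_≤?_; +-suc; +-identityʳ; +-comm; +-assoc; m∸n+n≡m; ≤-refl; ≤-reflexive; ≤-trans; <⇒≤;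
         ≤-<-trans; ≰⇒>; +-monoʳ-≤; +-mono-≤; m≤m+n; m<m+n)
open import Data.Product using (_×_; _,_; proj₁; proj₂; ∃-syntax)
import Data.Product as Product
open import Data.Sum using (_⊎_; inj₁; inj₂; [_,_]′)
import Data.Sum as Sum
open import Data.Vec using (Vec; []; _∷_; _∷ʳ_; head; tail)
open import Data.Vec.Properties using (∷ʳ-injectiveʳ)
open import Function using (_∘_; _⇔_; mk⇔)
open import Function.Properties.Equivalence using () renaming (trans to ⇔-trans)
open import Relation.Nullary using (¬_; Dec; yes; no; does; _×-dec_; contradiction)
open import Relation.Nullary.Decidable using (dec-true; dec-false)
open import Relation.Binary.PropositionalEquality
  using (_≡_; _≢_; refl; sym; trans; cong; cong₂; subst; subst₂; module ≡-Reasoning)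

foldr-attained : {A : Set} {_•_ : A → A → A} → Selective _≡_ _•_ →
                 (f : ℕ → A) (e : ℕ) (xs : List ℕ) → ∃[ i ] foldr _•_ (f e) (map f xs) ≡ f i
foldr-attained sel f e xs with foldr-selective sel (f e) (map f xs)
... | inj₁ eq = e , eq
... | inj₂ mem with i , _ , eq ← ∈-map⁻ f mem = i , eq

foldr-⊓-≤ : ∀ e {z} xs → z ∈ xs → foldr _⊓ℤ_ e xs ≤ℤ z
foldr-⊓-≤ e xs z∈ =
  foldr-preservesᵒ (λ a b → [ i≤j⇒i⊓k≤j b , i≤j⇒k⊓i≤j a ]′) e xs (inj₂ (lose z∈ ℤ.≤-refl))

foldr-⊔-≥ : ∀ e {z} xs → z ∈ xs → z ≤ℤ foldr _⊔ℤ_ e xs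
foldr-⊔-≥ e xs z∈ =
  foldr-preservesᵒ (λ a b → [ i≤j⇒i≤j⊔k b , i≤j⇒i≤k⊔j a ]′) e xs (inj₂ (lose z∈ ℤ.≤-refl))

between-ℤ : ∀ {X Y s} → (X ≤ s × s < Y) ⇔ (+ X ≤ℤ + s × + s ≤ℤ pred (+ Y))
between-ℤ = mk⇔ (Product.map +≤+ (i<j⇒i≤pred[j] ∘ +<+))
                (Product.map drop‿+≤+ (drop‿+<+ ∘ i≤pred[j]⇒i<j))

+-cancelˡ-≤ℤ : ∀ c {a b} → c +ℤ a ≤ℤ c +ℤ b → a ≤ℤ b
+-cancelˡ-≤ℤ c {a} {b} le = subst₂ _≤ℤ_ (cancel c a) (cancel c b) (ℤ.+-monoʳ-≤ (- c) le)
  where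
  cancel : ∀ c a → - c +ℤ (c +ℤ a) ≡ a
  cancel = solve-∀

IsMaxAt : (ℕ → ℤ) → ℕ → Set
IsMaxAt v j = ∀ t → v t ≤ℤ v j

IsMinAt : (ℕ → ℤ) → ℕ → Set
IsMinAt v j = ∀ t → v j ≤ℤ v t

module EarlyMaximum (N : ℕ) .{{_ : NonZero N}} (v β : ℕ → ℤ)
  (slide : ∀ j → v (suc j) ≡ v j +ℤ (β (j + N) - β j))
  (switch : ∀ j → β (j + N + N) ≤ℤ β j ⊎ IsMaxAt v j ⊎ IsMinAt v (suc (j + N))) where

  pairSum : ℕ → ℤ
  pairSum j = v j +ℤ v (j + N)

  pairSum-suc : ∀ j → pairSum (suc j) ≡ pairSum j +ℤ (β (j + N + N) - β j)
  pairSum-suc j = trans (cong₂ _+ℤ_ (slide j) (slide (j + N)))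
                        (telescope (v j) (β j) (β (j + N)) (v (j + N)) (β (j + N + N)))
    where
    telescope : ∀ a b c d e → (a +ℤ (c - b)) +ℤ (d +ℤ (e - c)) ≡ (a +ℤ d) +ℤ (e - b)
    telescope = solve-∀

  pairSum-mono : ∀ j → β (j + N + N) ≤ℤ β j → pairSum (suc j) ≤ℤ pairSum j
  pairSum-mono j le = begin
    pairSum (suc j)                      ≡⟨ pairSum-suc j ⟩
    pairSum j +ℤ (β (j + N + N) - β j)   ≤⟨ ℤ.+-monoʳ-≤ (pairSum j) (i≤j⇒i-j≤0 le) ⟩
    pairSum j +ℤ 0ℤ                      ≡⟨ ℤ.+-identityʳ (pairSum j) ⟩
    pairSum j                            ∎
    where open ℤ.≤-Reasoning

  PairBound : ℕ → ℕ → Set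
  PairBound c i = pairSum (c + N) ≤ℤ pairSum i

  pairSum-cancel : ∀ c {s} → pairSum (c + N) ≤ℤ v s +ℤ v (c + N) → v (c + N + N) ≤ℤ v s
  pairSum-cancel c {s} le = +-cancelˡ-≤ℤ (v (c + N)) (ℤ.≤-trans le (ℤ.≤-reflexive (ℤ.+-comm (v s) _)))

  below : ∀ c {s} → s ≤ c + N → s < c + N + N
  below c s≤ = ≤-<-trans s≤ (m<m+n (c + N) (>-nonZero⁻¹ N))

  -- Each case of switch (c + m) either carries the bound from c + suc m down to c + m or ends the
  -- descent at an earlier window; at m = 0 the bound itself gives v (c + 2N) ≤ v c.
  descend : ∀ m {c} → m ≤ N → PairBound c (c + m) → ∃[ s ] s < c + N + N × v (c + N + N) ≤ℤ v s
  descend zero    {c} _   le = c , below c (m≤m+n c N) , pairSum-cancel c (subst (PairBound c) (+-identityʳ c) le)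
  descend (suc m) {c} m<N le with switch (c + m) | subst (PairBound c) (+-suc c m) le
  ... | inj₁ β≤         | le′ = descend m (<⇒≤ m<N) (ℤ.≤-trans le′ (pairSum-mono (c + m) β≤))
  ... | inj₂ (inj₁ top) | _   = c + m , below c (+-monoʳ-≤ c (<⇒≤ m<N)) , top (c + N + N)
  ... | inj₂ (inj₂ bot) | le′ =
    suc (c + m) , below c (subst (_≤ c + N) (+-suc c m) (+-monoʳ-≤ c m<N)) ,
    pairSum-cancel c (ℤ.≤-trans le′ (ℤ.+-monoʳ-≤ (v (suc (c + m))) (bot (c + N))))

  bounded-by-earlier : ∀ c → ∃[ s ] s < c + N + N × v (c + N + N) ≤ℤ v s
  bounded-by-earlier c = descend N ≤-refl ℤ.≤-refl

  late-decomposition : ∀ {t} → ¬ t ≤ N + N → t ∸ (N + N) + N + N ≡ t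
  late-decomposition {t} t≰ = trans (+-assoc (t ∸ (N + N)) N N) (m∸n+n≡m (<⇒≤ (≰⇒> t≰)))

  bounded-by-initial : ∀ t → ∃[ i ] i ≤ N + N × v t ≤ℤ v i
  bounded-by-initial = <-rec _ go
    where
    go : ∀ t → (∀ {s} → s < t → ∃[ i ] i ≤ N + N × v s ≤ℤ v i) → ∃[ i ] i ≤ N + N × v t ≤ℤ v i
    go t rec with t ≤? N + N
    ... | yes t≤ = t , t≤ , ℤ.≤-refl
    ... | no t≰
      with s , s< , vt≤ ← bounded-by-earlier (t ∸ (N + N))
      with i , i≤ , vs≤ ← rec (subst (s <_) (late-decomposition t≰) s<) =
      i , i≤ , ℤ.≤-trans (subst (λ u → v u ≤ℤ v s) (late-decomposition t≰) vt≤) vs≤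

early-maximum : ∀ N .{{_ : NonZero N}} (v β : ℕ → ℤ) →
  (∀ j → v (suc j) ≡ v j +ℤ (β (j + N) - β j)) →
  (∀ j → β (j + N + N) ≤ℤ β j ⊎ IsMaxAt v j ⊎ IsMinAt v (suc (j + N))) →
  ∀ t → ∃[ i ] i ≤ N + N × v t ≤ℤ v i
early-maximum = EarlyMaximum.bounded-by-initial

early-minimum : ∀ N .{{_ : NonZero N}} (v β : ℕ → ℤ) →
  (∀ j → v (suc j) ≡ v j +ℤ (β (j + N) - β j)) →
  (∀ j → β j ≤ℤ β (j + N + N) ⊎ IsMinAt v j ⊎ IsMaxAt v (suc (j + N))) →
  ∀ t → ∃[ i ] i ≤ N + N × v i ≤ℤ v t
early-minimum N v β slide switch t =
  Product.map₂ (Product.map₂ neg-cancel-≤) (early-maximum N (-_ ∘ v) (-_ ∘ β) slide⁻ switch⁻ t)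
  where
  negate : ∀ a b c → - (a +ℤ (b - c)) ≡ - a +ℤ (- b - - c)
  negate = solve-∀
  slide⁻ : ∀ j → - v (suc j) ≡ - v j +ℤ (- β (j + N) - - β j)
  slide⁻ j = trans (cong -_ (slide j)) (negate (v j) (β (j + N)) (β j))
  switch⁻ : ∀ j → - β (j + N + N) ≤ℤ - β j ⊎ IsMaxAt (-_ ∘ v) j ⊎ IsMinAt (-_ ∘ v) (suc (j + N))
  switch⁻ j = Sum.map neg-mono-≤ (Sum.map (λ min t → neg-mono-≤ (min t)) (λ max t → neg-mono-≤ (max t)))
                      (switch j)

segment : {A : Set} → (ℕ → A) → ℕ → (m : ℕ) → Vec A m
segment f i zero    = []
segment f i (suc m) = f i ∷ segment f (suc i) m

segment-cong-suc : {A : Set} {f g : ℕ → A} → (∀ j → f j ≡ g (suc j)) →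
                   ∀ (i m : ℕ) → segment f i m ≡ segment g (suc i) m
segment-cong-suc f≡g i zero    = refl
segment-cong-suc f≡g i (suc m) = cong₂ _∷_ (f≡g i) (segment-cong-suc f≡g (suc i) m)

segment-∷ʳ : {A : Set} (f : ℕ → A) (i m : ℕ) → segment f i (suc m) ≡ segment f i m ∷ʳ f (i + m)
segment-∷ʳ f i zero    = cong (λ j → f j ∷ []) (sym (+-identityʳ i))
segment-∷ʳ f i (suc m) = cong (f i ∷_) (begin
  segment f (suc i) (suc m)            ≡⟨ segment-∷ʳ f (suc i) m ⟩
  segment f (suc i) m ∷ʳ f (suc i + m) ≡⟨ cong (λ j → segment f (suc i) m ∷ʳ f j) (sym (+-suc i m)) ⟩
  segment f (suc i) m ∷ʳ f (i + suc m) ∎)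
  where open ≡-Reasoning

head-∷-tail : {A : Set} {n : ℕ} (v : Vec A (suc n)) → v ≡ head v ∷ tail v
head-∷-tail (x ∷ xs) = refl

head-∷ʳ : {A : Set} {n : ℕ} (v : Vec A (suc n)) (y : A) → head (v ∷ʳ y) ≡ head v
head-∷ʳ (x ∷ xs) y = refl

tail-∷ʳ : {A : Set} {n : ℕ} (v : Vec A (suc n)) (y : A) → tail (v ∷ʳ y) ≡ tail v ∷ʳ y
tail-∷ʳ (x ∷ xs) y = refl

shift-register-segment : {A : Set} (n : ℕ) (W : ℕ → Vec A (suc n)) (y : ℕ → A) →
  (∀ i → W (suc i) ≡ tail (W i) ∷ʳ y i) → ∀ i → W i ≡ segment (head ∘ W) i (suc n)
shift-register-segment zero W y shift i with W i
... | z ∷ [] = refl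
shift-register-segment (suc n) W y shift i = begin
  W i                                              ≡⟨ head-∷-tail (W i) ⟩
  head (W i) ∷ tail (W i)                          ≡⟨ cong (head (W i) ∷_) (shift-register-segment n (tail ∘ W) y shift′ i) ⟩
  head (W i) ∷ segment (head ∘ tail ∘ W) i (suc n) ≡⟨ cong (head (W i) ∷_) (segment-cong-suc head-tail i (suc n)) ⟩
  segment (head ∘ W) i (suc (suc n))               ∎
  where
  open ≡-Reasoning
  shift′ : ∀ i → tail (W (suc i)) ≡ tail (tail (W i)) ∷ʳ y i
  shift′ i = trans (cong tail (shift i)) (tail-∷ʳ (tail (W i)) (y i))
  head-tail : ∀ j → head (tail (W j)) ≡ head (W (suc j))
  head-tail j = trans (sym (head-∷ʳ (tail (W j)) (y j))) (cong head (sym (shift j)))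

shift-register-feedback : {A : Set} (n : ℕ) (W : ℕ → Vec A (suc n)) (y : ℕ → A) →
  (∀ i → W (suc i) ≡ tail (W i) ∷ʳ y i) → ∀ i → y i ≡ head (W (suc i + n))
shift-register-feedback n W y shift i = ∷ʳ-injectiveʳ (tail (W i)) (segment (head ∘ W) (suc i) n) (begin
  tail (W i) ∷ʳ y i                                    ≡⟨ sym (shift i) ⟩
  W (suc i)                                            ≡⟨ shift-register-segment n W y shift (suc i) ⟩
  segment (head ∘ W) (suc i) (suc n)                   ≡⟨ segment-∷ʳ (head ∘ W) (suc i) n ⟩
  segment (head ∘ W) (suc i) n ∷ʳ head (W (suc i + n)) ∎)
  where open ≡-Reasoning

sumFrom-cong-suc : {f g : ℕ → ℕ} → (∀ j → f (suc j) ≡ g j) →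
                   ∀ (i m : ℕ) → sumFrom f (suc i) m ≡ sumFrom g i m
sumFrom-cong-suc f≡g i zero    = refl
sumFrom-cong-suc f≡g i (suc m) = cong₂ _+_ (f≡g i) (sumFrom-cong-suc f≡g (suc i) m)

sumFrom-suc : (f : ℕ → ℕ) (i m : ℕ) → sumFrom f i (suc m) ≡ sumFrom f i m + f (i + m)
sumFrom-suc f i zero    = trans (+-comm (f i) 0) (cong f (sym (+-identityʳ i)))
sumFrom-suc f i (suc m) = begin
  f i + sumFrom f (suc i) (suc m)             ≡⟨ cong (λ s → f i + s) (sumFrom-suc f (suc i) m) ⟩
  f i + (sumFrom f (suc i) m + f (suc i + m)) ≡⟨ sym (+-assoc (f i) _ _) ⟩
  sumFrom f i (suc m) + f (suc i + m)         ≡⟨ cong (λ j → sumFrom f i (suc m) + f j) (sym (+-suc i m)) ⟩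
  sumFrom f i (suc m) + f (i + suc m)         ∎
  where open ≡-Reasoning

weight-segment : (f : ℕ → Bool) (i m : ℕ) → weight (segment f i m) ≡ sumFrom (bit ∘ f) i m
weight-segment f i zero    = refl
weight-segment f i (suc m) = cong (λ s → bit (f i) + s) (weight-segment f (suc i) m)

bit-not : ∀ b → bit (not b) ≡ 1 ∸ bit b
bit-not true  = refl
bit-not false = refl

bit≢1∸bit : ∀ b → bit b ≢ 1 ∸ bit b
bit≢1∸bit true  ()
bit≢1∸bit false ()

bit≤1 : ∀ b → bit b ≤ 1
bit≤1 true  = s≤s z≤n
bit≤1 false = z≤n

bit≤⊎rise : ∀ a b → bit b ≤ bit a ⊎ (a ≡ false × b ≡ true)
bit≤⊎rise a     false = inj₁ z≤n
bit≤⊎rise true  true  = inj₁ ≤-refl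
bit≤⊎rise false true  = inj₂ (refl , refl)

module _ (k p : ℕ) where

  Flips : ℕ → Set
  Flips s = k ≤ s × s ≤ k + p

  flips? : ∀ s → Dec (Flips s)
  flips? s = k ≤? s ×-dec s ≤? k + p

  -- does (flips? s) reduces to (k ≤ᵇ s) ∧ (s ≤ᵇ k + p), the test in step, so step-∷ʳ below is refl.
  feedback : Bool → ℕ → Bool
  feedback x s = if does (flips? s) then not x else x

  feedback-flip : ∀ x {s} → Flips s → feedback x s ≡ not x
  feedback-flip x {s} f = cong (λ b → if b then not x else x) (dec-true (flips? s) f)

  feedback-keep : ∀ x {s} → ¬ Flips s → feedback x s ≡ x
  feedback-keep x {s} ¬f = cong (λ b → if b then not x else x) (dec-false (flips? s) ¬f)

module SymmetricRegister (k p n : ℕ) (x : ℕ → Bool)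
  (rule : ∀ i → x (i + suc n) ≡ feedback k p (x i) (sumFrom (bit ∘ x) (suc i) n)) where

  -- x i is a_{i+1}, so V i = a_{i+1} + ⋯ + a_{i+N} = w_i + k and S i = a_{i+2} + ⋯ + a_{i+N}.
  N : ℕ
  N = suc n

  V : ℕ → ℕ
  V i = sumFrom (bit ∘ x) i N

  S : ℕ → ℕ
  S i = sumFrom (bit ∘ x) (suc i) n

  V-head : ∀ {i b} → x i ≡ b → V i ≡ bit b + S i
  V-head {i} = cong (λ b → bit b + S i)

  V-suc : ∀ {i b} → x (i + N) ≡ b → V (suc i) ≡ S i + bit b
  V-suc {i} {b} x≡b = begin
    V (suc i)                 ≡⟨ sumFrom-suc (bit ∘ x) (suc i) n ⟩
    S i + bit (x (suc i + n)) ≡⟨ cong (λ j → S i + bit (x j)) (sym (+-suc i n)) ⟩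
    S i + bit (x (i + N))     ≡⟨ cong (λ b → S i + bit b) x≡b ⟩
    S i + bit b               ∎
    where open ≡-Reasoning

  V-slide : ∀ j → + V (suc j) ≡ + V j +ℤ (+ bit (x (j + N)) - + bit (x j))
  V-slide j = trans (cong +_ (V-suc refl)) (slide (+ S j) (+ bit (x j)) (+ bit (x (j + N))))
    where
    slide : ∀ s a b → s +ℤ b ≡ (a +ℤ s) +ℤ (b - a)
    slide = solve-∀

  flip-rule : ∀ i → Flips k p (S i) → x (i + N) ≡ not (x i)
  flip-rule i f = trans (rule i) (feedback-flip k p (x i) f)

  keep-rule : ∀ i → ¬ Flips k p (S i) → x (i + N) ≡ x i
  keep-rule i ¬f = trans (rule i) (feedback-keep k p (x i) ¬f)

  V-suc-flip : ∀ {i b} → Flips k p (S i) → x i ≡ b → V (suc i) ≡ S i + bit (not b)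
  V-suc-flip {i} f xi = V-suc (trans (flip-rule i f) (cong not xi))

  keep-stationary : ∀ i → ¬ Flips k p (S i) → V (suc i) ≡ V i
  keep-stationary i ¬f = trans (V-suc (keep-rule i ¬f)) (+-comm (S i) (bit (x i)))

  flip-twice : ∀ i → Flips k p (S i) → Flips k p (S (i + N)) → x (i + N + N) ≡ x i
  flip-twice i f f′ = begin
    x (i + N + N)    ≡⟨ flip-rule (i + N) f′ ⟩
    not (x (i + N))  ≡⟨ cong not (flip-rule i f) ⟩
    not (not (x i))  ≡⟨ not-involutive (x i) ⟩
    x i              ∎
    where open ≡-Reasoning

  flips-iff-between : ∀ {X Y} → k ≤ X → (∀ t → X ≤ V t) → (∀ t → V t ≤ Y) → Y ≤ suc (k + p) →
                      ∀ r → bit (x (r + N)) ≡ 1 ∸ bit (x r) ⇔ (X ≤ S r × S r < Y)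
  flips-iff-between {X} {Y} k≤X X≤V V≤Y Y≤ r = mk⇔ to from
    where
    to : bit (x (r + N)) ≡ 1 ∸ bit (x r) → X ≤ S r × S r < Y
    to b≡ with flips? k p (S r) | x r in xr
    ... | no ¬f | b     = contradiction (trans (cong bit (sym (trans (keep-rule r ¬f) xr))) b≡) (bit≢1∸bit b)
    ... | yes f | false = subst (X ≤_) (V-head xr) (X≤V r) ,
                          subst (_≤ Y) (trans (V-suc-flip f xr) (+-comm (S r) 1)) (V≤Y (suc r))
    ... | yes f | true  = subst (X ≤_) (trans (V-suc-flip f xr) (+-identityʳ (S r))) (X≤V (suc r)) ,
                          subst (_≤ Y) (V-head xr) (V≤Y r)
    from : X ≤ S r × S r < Y → bit (x (r + N)) ≡ 1 ∸ bit (x r)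
    from (X≤S , S<Y) =
      trans (cong bit (flip-rule r (≤-trans k≤X X≤S , s≤s⁻¹ (≤-trans S<Y Y≤)))) (bit-not (x r))

  module Bounded (k≤V₀ : k ≤ V 0) (V₀≤ : V 0 ≤ suc (k + p)) where

    V-bounds : ∀ i → k ≤ V i × V i ≤ suc (k + p)
    V-bounds zero = k≤V₀ , V₀≤
    V-bounds (suc i) with flips? k p (S i)
    ... | yes (k≤S , S≤) =
      subst (λ v → k ≤ v × v ≤ suc (k + p)) (sym (V-suc refl))
        (≤-trans k≤S (m≤m+n (S i) _) , ≤-trans (+-mono-≤ S≤ (bit≤1 _)) (≤-reflexive (+-comm (k + p) 1)))
    ... | no ¬f = subst (λ v → k ≤ v × v ≤ suc (k + p)) (sym (keep-stationary i ¬f)) (V-bounds i)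

    keep-top : ∀ i → ¬ Flips k p (S i) → x i ≡ false → k + p < V i
    keep-top i ¬f xi = subst (k + p <_) (sym (V-head xi))
      (≰⇒> (λ S≤ → ¬f (subst (k ≤_) (V-head xi) (proj₁ (V-bounds i)) , S≤)))

    keep-bottom : ∀ i → ¬ Flips k p (S i) → x i ≡ true → V i ≤ k
    keep-bottom i ¬f xi = subst (_≤ k) (sym (V-head xi))
      (≰⇒> (λ k≤S → ¬f (k≤S , s≤s⁻¹ (subst (_≤ suc (k + p)) (V-head xi) (proj₂ (V-bounds i))))))

    switch-up : ∀ j → x j ≡ false → x (j + N + N) ≡ true → k + p < V j ⊎ V (suc (j + N)) ≤ k
    switch-up j xj xj″ with flips? k p (S j) | flips? k p (S (j + N))
    ... | no ¬f | _      = inj₁ (keep-top j ¬f xj)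
    ... | yes f | yes f′ = contradiction (trans (sym xj″) (trans (flip-twice j f f′) xj)) λ ()
    ... | yes f | no ¬f′ = inj₂ (subst (_≤ k) (sym (keep-stationary (j + N) ¬f′))
                                  (keep-bottom (j + N) ¬f′ (trans (sym (keep-rule (j + N) ¬f′)) xj″)))

    switch-down : ∀ j → x j ≡ true → x (j + N + N) ≡ false → V j ≤ k ⊎ k + p < V (suc (j + N))
    switch-down j xj xj″ with flips? k p (S j) | flips? k p (S (j + N))
    ... | no ¬f | _      = inj₁ (keep-bottom j ¬f xj)
    ... | yes f | yes f′ = contradiction (trans (sym xj) (trans (sym (flip-twice j f f′)) xj″)) λ ()
    ... | yes f | no ¬f′ = inj₂ (subst (k + p <_) (sym (keep-stationary (j + N) ¬f′))
                                  (keep-top (j + N) ¬f′ (trans (sym (keep-rule (j + N) ¬f′)) xj″)))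

    top-isMax : ∀ {j} → k + p < V j → IsMaxAt (+_ ∘ V) j
    top-isMax top t = +≤+ (≤-trans (proj₂ (V-bounds t)) top)

    bottom-isMin : ∀ {j} → V j ≤ k → IsMinAt (+_ ∘ V) j
    bottom-isMin bot t = +≤+ (≤-trans bot (proj₁ (V-bounds t)))

    switch-max : ∀ j → + bit (x (j + N + N)) ≤ℤ + bit (x j) ⊎
                       IsMaxAt (+_ ∘ V) j ⊎ IsMinAt (+_ ∘ V) (suc (j + N))
    switch-max j with bit≤⊎rise (x j) (x (j + N + N))
    ... | inj₁ le         = inj₁ (+≤+ le)
    ... | inj₂ (xj , xj″) = inj₂ (Sum.map top-isMax bottom-isMin (switch-up j xj xj″))

    switch-min : ∀ j → + bit (x j) ≤ℤ + bit (x (j + N + N)) ⊎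
                       IsMinAt (+_ ∘ V) j ⊎ IsMaxAt (+_ ∘ V) (suc (j + N))
    switch-min j with bit≤⊎rise (x (j + N + N)) (x j)
    ... | inj₁ le         = inj₁ (+≤+ le)
    ... | inj₂ (xj″ , xj) = inj₂ (Sum.map bottom-isMin top-isMax (switch-down j xj xj″))

    V-max-early : ∀ t → ∃[ i ] i ≤ N + N × V t ≤ V i
    V-max-early t = Product.map₂ (Product.map₂ drop‿+≤+)
      (early-maximum N (+_ ∘ V) (+_ ∘ bit ∘ x) V-slide switch-max t)

    V-min-early : ∀ t → ∃[ i ] i ≤ N + N × V i ≤ V t
    V-min-early t = Product.map₂ (Product.map₂ drop‿+≤+)
      (early-minimum N (+_ ∘ V) (+_ ∘ bit ∘ x) V-slide switch-min t)

step-∷ʳ : ∀ k p {n} (v : Vec Bool (suc n)) → step k p v ≡ tail v ∷ʳ feedback k p (head v) (weight (tail v))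
step-∷ʳ k p (x ∷ xs) = refl

firstBit-head : ∀ k p {n} (v : Vec Bool (suc n)) → firstBit k p v ≡ bit (head v)
firstBit-head k p (x ∷ xs) = refl

module Windows (k p : ℕ) {n : ℕ} (A : Vec Bool (suc n)) where

  bits : ℕ → Bool
  bits i = head (window k p A i)

  private
    new : ℕ → Bool
    new i = feedback k p (bits i) (weight (tail (window k p A i)))

    shift : ∀ i → window k p A (suc i) ≡ tail (window k p A i) ∷ʳ new i
    shift i = step-∷ʳ k p (window k p A i)

  window-segment : ∀ i → window k p A i ≡ segment bits i (suc n)
  window-segment = shift-register-segment n (window k p A) new shift

  bits-rule : ∀ i → bits (i + suc n) ≡ feedback k p (bits i) (sumFrom (bit ∘ bits) (suc i) n)
  bits-rule i = begin
    bits (i + suc n)  ≡⟨ cong bits (+-suc i n) ⟩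
    bits (suc i + n)  ≡⟨ sym (shift-register-feedback n (window k p A) new shift i) ⟩
    new i             ≡⟨ cong (feedback k p (bits i)) weight-tail ⟩
    feedback k p (bits i) (sumFrom (bit ∘ bits) (suc i) n) ∎
    where
    open ≡-Reasoning
    weight-tail : weight (tail (window k p A i)) ≡ sumFrom (bit ∘ bits) (suc i) n
    weight-tail = trans (cong (weight ∘ tail) (window-segment i)) (weight-segment bits (suc i) n)

  seqA-bits : ∀ j → seqA k p A (suc j) ≡ bit (bits j)
  seqA-bits j = firstBit-head k p (window k p A j)

  sumFrom-seqA : ∀ i m → sumFrom (seqA k p A) (suc i) m ≡ sumFrom (bit ∘ bits) i m
  sumFrom-seqA = sumFrom-cong-suc seqA-bits

  weight-initial : weight A ≡ sumFrom (bit ∘ bits) 0 (suc n)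
  weight-initial = trans (cong weight (window-segment 0)) (weight-segment bits 0 (suc n))

module WindowExtremes (k p n : ℕ) (A : Vec Bool (suc n))
  (k≤wA : k ≤ weight A) (wA≤ : weight A ≤ k + p + 1) where

  open Windows k p A public
  open SymmetricRegister k p n bits bits-rule public
  open Bounded (subst (k ≤_) weight-initial k≤wA)
               (subst (_≤ suc (k + p)) weight-initial (≤-trans wA≤ (≤-reflexive (+-comm (k + p) 1)))) public

  k+wI : ∀ i → + k +ℤ wI k p A i ≡ + V i
  k+wI i = trans (cong (λ s → + k +ℤ (+ s - + k)) (sumFrom-seqA i N)) (shift (+ k) (+ V i))
    where
    shift : ∀ a b → a +ℤ (b - a) ≡ b
    shift = solve-∀

  wI-mono : ∀ {i j} → V i ≤ V j → wI k p A i ≤ℤ wI k p A j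
  wI-mono {i} {j} le = +-cancelˡ-≤ℤ (+ k) (subst₂ _≤ℤ_ (sym (k+wI i)) (sym (k+wI j)) (+≤+ le))

  wI-reflect : ∀ {i j} → wI k p A i ≤ℤ wI k p A j → V i ≤ V j
  wI-reflect {i} {j} le = drop‿+≤+ (subst₂ _≤ℤ_ (k+wI i) (k+wI j) (ℤ.+-monoʳ-≤ (+ k) le))

  wValues : List ℤ
  wValues = map (wI k p A) (upTo (suc (2 * N)))

  wI-∈-wValues : ∀ {i} → i ≤ N + N → wI k p A i ∈ wValues
  wI-∈-wValues {i} i≤ =
    ∈-map⁺ (wI k p A) (∈-upTo⁺ {n = suc (2 * N)} (s≤s (subst (i ≤_) (cong (λ m → N + m) (sym (+-identityʳ N))) i≤)))

  minW≤wI : ∀ t → minW k p A ≤ℤ wI k p A t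
  minW≤wI t = let (i , i≤ , Vi≤) = V-min-early t
              in ℤ.≤-trans (foldr-⊓-≤ (wI k p A 0) wValues (wI-∈-wValues i≤)) (wI-mono Vi≤)

  wI≤maxW : ∀ t → wI k p A t ≤ℤ maxW k p A
  wI≤maxW t = let (i , i≤ , ≤Vi) = V-max-early t
              in ℤ.≤-trans (wI-mono ≤Vi) (foldr-⊔-≥ (wI k p A 0) wValues (wI-∈-wValues i≤))

  kStar-at : ∀ {i} → minW k p A ≡ wI k p A i → kStar k p A ≡ + V i
  kStar-at {i} minW≡ = trans (cong (+ k +ℤ_) minW≡) (k+wI i)

  kStar+pStar-at : ∀ {j} → maxW k p A ≡ wI k p A j → kStar k p A +ℤ pStar k p A ≡ pred (+ V j)
  kStar+pStar-at {j} maxW≡ =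
    trans (collapse (+ k) (minW k p A) (maxW k p A) (+ 1)) (cong pred (trans (cong (+ k +ℤ_) maxW≡) (k+wI j)))
    where
    collapse : ∀ K m M o → (K +ℤ m) +ℤ (M - m - o) ≡ - o +ℤ (K +ℤ M)
    collapse = solve-∀

  minimum-window : ∃[ i ] kStar k p A ≡ + V i × (∀ t → V i ≤ V t)
  minimum-window =
    let (i , minW≡) = foldr-attained ⊓-sel (wI k p A) 0 (upTo (suc (2 * N)))
    in i , kStar-at minW≡ , λ t → wI-reflect (subst (_≤ℤ wI k p A t) minW≡ (minW≤wI t))

  maximum-window : ∃[ j ] kStar k p A +ℤ pStar k p A ≡ pred (+ V j) × (∀ t → V t ≤ V j)
  maximum-window =
    let (j , maxW≡) = foldr-attained ⊔-sel (wI k p A) 0 (upTo (suc (2 * N)))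
    in j , kStar+pStar-at maxW≡ , λ t → wI-reflect (subst (wI k p A t ≤ℤ_) maxW≡ (wI≤maxW t))

  seqA-+1 : ∀ j → seqA k p A (j + 1) ≡ bit (bits j)
  seqA-+1 j = trans (cong (seqA k p A) (+-comm j 1)) (seqA-bits j)

  sumFrom-seqA-+2 : ∀ r → sumFrom (seqA k p A) (r + 2) n ≡ S r
  sumFrom-seqA-+2 r = trans (cong (λ a → sumFrom (seqA k p A) a n) (+-comm r 2)) (sumFrom-seqA (suc r) n)

criterion-cong : ∀ {a a′ b b′ s s′ : ℕ} {K K′ T T′ : ℤ} → a ≡ a′ → b ≡ b′ → s ≡ s′ → K ≡ K′ → T ≡ T′ →
  (a ≡ 1 ∸ b) ⇔ (K ≤ℤ + s × + s ≤ℤ T) → (a′ ≡ 1 ∸ b′) ⇔ (K′ ≤ℤ + s′ × + s′ ≤ℤ T′)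
criterion-cong refl refl refl refl refl criterion = criterion

proposition79p1 : (k p n : ℕ) → k + p < n → (A : Vec Bool n) →
    k ≤ weight A → weight A ≤ k + p + 1 → (r : ℕ) →
    (seqA k p A (r + n + 1) ≡ 1 ∸ seqA k p A (r + 1)) ⇔
      ((kStar k p A ≤ℤ + sumFrom (seqA k p A) (r + 2) (n ∸ 1)) ×
       (+ sumFrom (seqA k p A) (r + 2) (n ∸ 1) ≤ℤ kStar k p A +ℤ pStar k p A))
-- The hypothesis k + p < n only serves to exclude n = 0.
proposition79p1 k p zero () A k≤wA wA≤ r
proposition79p1 k p (suc n) _ A k≤wA wA≤ r =
  let (i , kStar≡ , minimal) = minimum-window
      (j , top≡ , maximal)   = maximum-window
  in criterion-cong (sym (seqA-+1 (r + N))) (sym (seqA-+1 r)) (sym (sumFrom-seqA-+2 r)) (sym kStar≡) (sym top≡)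
       (⇔-trans (flips-iff-between (proj₁ (V-bounds i)) minimal maximal (proj₂ (V-bounds j)) r) between-ℤ)
  where open WindowExtremes k p n A k≤wA wA≤
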